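{- Every graph in $\varepsilon_{01}$ has a node of degree $2$.
   Context: All graphs are finite, simple and connected. An Euler graph is a connected graph all of whose nodes have even degree. A cycle of length $n$ is of type $i$ if $n\equiv i\pmod 4$. $\varepsilon_{01}$ is the class of Euler graphs in which every cycle has length $\equiv 0$ or $\equiv 1\pmod 4$ and which contain at least one cycle of each of the types $0$ and $1$. -}

module Defs where

open import Data.Nat using (ℕ; zero; suc; _+_; _≥_; _%_)
open import Data.Nat.Divisibility using (_∣_)
open import Data.Bool using (Bool; true; false; if_then_else_)
open import Data.Fin using (Fin)
open import Data.List using (List; []; _∷_; length; map; allFin)
open import Data.Nat.ListAction using (sum)
open import Data.Unit using (⊤)
open import Data.List.Relation.Unary.Unique.Propositional using (Unique)
open import Data.Product using (_×_; ∃; ∃-syntax)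
open import Data.Sum using (_⊎_)
open import Data.Empty using (⊥)
open import Relation.Binary.PropositionalEquality using (_≡_)

record Graph (n : ℕ) : Set where
  field
    adj   : Fin n → Fin n → Bool
    sym   : ∀ i j → adj i j ≡ adj j i
    irrefl : ∀ i → adj i i ≡ false
open Graph public

Adj : ∀ {n} → Graph n → Fin n → Fin n → Set
Adj G i j = adj G i j ≡ true

degree : ∀ {n} → Graph n → Fin n → ℕ
degree {n} G i = sum (map (λ j → if adj G i j then 1 else 0) (allFin n))

data Walk {n} (G : Graph n) : Fin n → Fin n → Set where
  here : ∀ {x} → Walk G x x
  step : ∀ {x y z} → Adj G x y → Walk G y z → Walk G x z

Connected : ∀ {n} → Graph n → Set
Connected {n} G = ∀ (x y : Fin n) → Walk G x y

Chain : ∀ {n} → Graph n → List (Fin n) → Set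
Chain G []            = ⊤
Chain G (x ∷ [])      = ⊤
Chain G (x ∷ y ∷ vs)  = Adj G x y × Chain G (y ∷ vs)

last : ∀ {A : Set} → A → List A → A
last x []       = x
last x (y ∷ ys) = last y ys

record Cycle {n} (G : Graph n) : Set where
  constructor mkCycle
  field
    v₀     : Fin n
    rest   : List (Fin n)
    len≥3  : suc (length rest) ≥ 3
    unique : Unique (v₀ ∷ rest)
    chain  : Chain G (v₀ ∷ rest)
    close  : Adj G (last v₀ rest) v₀
open Cycle public

cycleLength : ∀ {n} {G : Graph n} → Cycle G → ℕ
cycleLength C = suc (length (rest C))

Euler : ∀ {n} → Graph n → Set
Euler {n} G = Connected G × (∀ (i : Fin n) → 2 ∣ degree G i)

Eps01 : ∀ {n} → Graph n → Set
Eps01 G =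
  Euler G
  × (∀ (C : Cycle G) → (cycleLength C % 4 ≡ 0) ⊎ (cycleLength C % 4 ≡ 1))
  × (∃[ C ] (cycleLength {G = G} C % 4 ≡ 0))
  × (∃[ C ] (cycleLength {G = G} C % 4 ≡ 1))

-- Suppose no vertex has degree 2. Extend a cycle, read as a path, to a path v x₁ … x_m
-- that cannot be extended at v; then every neighbour of v is some xᵢ, and deg v is even
-- and nonzero, hence at least 4. If xᵢ₁, …, xᵢ₄ are the first four of them, the chords
-- v xᵢⱼ close cycles of lengths ℓⱼₖ = iₖ − iⱼ + 2, with ℓ₁₂ + ℓ₂₃ = ℓ₁₃ + 2 and
-- ℓ₁₃ + ℓ₃₄ = ℓ₁₄ + 2. When all cycle lengths are ≡ 0 or 1 (mod 4) the first identity
-- forces ℓ₁₃ ≡ 0 and the second ℓ₁₃ ≡ 1.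

module Submission where

open import Defs hiding (sym)
open import Data.Bool using (Bool; true; false; if_then_else_) renaming (_≟_ to _≟ᵇ_)
open import Data.Fin using (Fin) renaming (_≟_ to _≟ᶠ_)
open import Data.Fin.Properties using (any?)
open import Data.List using (List; []; _∷_; _++_; [_]; length; map; filter; allFin)
open import Data.List.Properties using (length-++; length-tabulate; ++-assoc)
open import Data.List.Membership.Propositional using (_∈_)
open import Data.List.Membership.Propositional.Properties
  using (∈-∃++; ∈-++⁻; ∈-++⁺ˡ; ∈-++⁺ʳ; ∈-filter⁺; ∈-filter⁻; ∈-allFin)
open import Data.List.Relation.Binary.Subset.Propositional using (_⊆_)
import Data.List.Relation.Unary.All as All
open import Data.List.Relation.Unary.All.Properties using (¬Any⇒All¬; ++⁻ˡ; ++⁻ʳ)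
open import Data.List.Relation.Unary.AllPairs using ([]; _∷_)
open import Data.List.Relation.Unary.Any as Any using (here; there)
open import Data.List.Relation.Unary.Unique.Propositional using (Unique)
open import Data.List.Relation.Unary.Unique.Propositional.Properties using (allFin⁺; filter⁺)
open import Data.Nat using (ℕ; zero; suc; _+_; _≤_; _<_; _%_; z≤n; s≤s; s≤s⁻¹; _≟_)
open import Data.Nat.DivMod using (%-distribˡ-+)
open import Data.Nat.Divisibility using (_∣_; divides)
open import Data.Nat.ListAction using (sum)
open import Data.Nat.Properties using (≤-trans; ≤-reflexive; +-suc; +-comm; m<m+n; <⇒≱)
open import Data.Nat.Tactic.RingSolver using (solve-∀)
open import Data.Product using (Σ; ∃-syntax; _×_; _,_; proj₁; proj₂)
open import Data.Sum using (_⊎_; inj₁; inj₂)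
open import Data.Unit using (tt)
open import Relation.Unary using (Decidable)
open import Relation.Nullary using (¬_; yes; no; contradiction; _×-dec_; ¬?)
open import Relation.Nullary.Decidable using (decidable-stable)
open import Relation.Binary.PropositionalEquality
  using (_≡_; _≢_; refl; sym; trans; cong; subst; module ≡-Reasoning)

Type01 : ℕ → Set
Type01 k = k % 4 ≡ 0 ⊎ k % 4 ≡ 1

type01-shift : ∀ x y z → Type01 x → Type01 y → Type01 z → x + y ≡ z + 2 →
               x % 4 ≡ 1 × z % 4 ≡ 0
type01-shift x y z tx ty tz x+y≡z+2 = residues tx ty tz (begin
    (x % 4 + y % 4) % 4 ≡⟨ %-distribˡ-+ x y 4 ⟨
    (x + y) % 4         ≡⟨ cong (_% 4) x+y≡z+2 ⟩
    (z + 2) % 4         ≡⟨ %-distribˡ-+ z 2 4 ⟩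
    (z % 4 + 2) % 4     ∎)
  where
  open ≡-Reasoning
  residues : ∀ {r s t} → r ≡ 0 ⊎ r ≡ 1 → s ≡ 0 ⊎ s ≡ 1 → t ≡ 0 ⊎ t ≡ 1 →
             (r + s) % 4 ≡ (t + 2) % 4 → r ≡ 1 × t ≡ 0
  residues (inj₂ refl) (inj₂ refl) (inj₁ refl) _ = refl , refl
  residues (inj₁ refl) (inj₁ refl) (inj₁ refl) ()
  residues (inj₁ refl) (inj₁ refl) (inj₂ refl) ()
  residues (inj₁ refl) (inj₂ refl) (inj₁ refl) ()
  residues (inj₁ refl) (inj₂ refl) (inj₂ refl) ()
  residues (inj₂ refl) (inj₁ refl) (inj₁ refl) ()
  residues (inj₂ refl) (inj₁ refl) (inj₂ refl) ()
  residues (inj₂ refl) (inj₂ refl) (inj₂ refl) ()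

even-≢2⇒≥4 : ∀ {d} → 2 ∣ d → 0 < d → d ≢ 2 → 4 ≤ d
even-≢2⇒≥4 (divides zero refl)          ()
even-≢2⇒≥4 (divides (suc zero) refl)    _ d≢2 = contradiction refl d≢2
even-≢2⇒≥4 (divides (suc (suc q)) refl) _ _   = s≤s (s≤s (s≤s (s≤s z≤n)))

module _ {A : Set} where

  unique-++⁻ˡ : ∀ xs {ys : List A} → Unique (xs ++ ys) → Unique xs
  unique-++⁻ˡ []       _          = []
  unique-++⁻ˡ (x ∷ xs) (x∉ ∷ u) = ++⁻ˡ xs x∉ ∷ unique-++⁻ˡ xs u

  unique-++⁻ʳ : ∀ xs {ys : List A} → Unique (xs ++ ys) → Unique ys
  unique-++⁻ʳ []       u       = u
  unique-++⁻ʳ (x ∷ xs) (_ ∷ u) = unique-++⁻ʳ xs u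

  length-insert : ∀ xs (x : A) ys → length (xs ++ x ∷ ys) ≡ suc (length (xs ++ ys))
  length-insert xs x ys = begin
    length (xs ++ x ∷ ys)           ≡⟨ length-++ xs ⟩
    length xs + suc (length ys)     ≡⟨ +-suc (length xs) (length ys) ⟩
    suc (length xs + length ys)     ≡⟨ cong suc (length-++ xs) ⟨
    suc (length (xs ++ ys))         ∎
    where open ≡-Reasoning

  unique-⊆⇒length≤ : ∀ {xs ys : List A} → Unique xs → xs ⊆ ys → length xs ≤ length ys
  unique-⊆⇒length≤ {[]}     _            _     = z≤n
  unique-⊆⇒length≤ {x ∷ xs} (x∉xs ∷ uxs) x∷xs⊆ys
    with ys₁ , ys₂ , refl ← ∈-∃++ (x∷xs⊆ys (here refl)) =
    ≤-trans (s≤s (unique-⊆⇒length≤ uxs xs⊆ys₁++ys₂))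
            (≤-reflexive (sym (length-insert ys₁ x ys₂)))
    where
    xs⊆ys₁++ys₂ : xs ⊆ ys₁ ++ ys₂
    xs⊆ys₁++ys₂ {y} y∈xs with ∈-++⁻ ys₁ (x∷xs⊆ys (there y∈xs))
    ... | inj₁ y∈ys₁         = ∈-++⁺ˡ y∈ys₁
    ... | inj₂ (here refl)   = contradiction refl (All.lookup x∉xs y∈xs)
    ... | inj₂ (there y∈ys₂) = ∈-++⁺ʳ ys₁ y∈ys₂

  sum-indicator≡length-filter : ∀ (p : A → Bool) xs →
    sum (map (λ x → if p x then 1 else 0) xs) ≡ length (filter (λ x → p x ≟ᵇ true) xs)
  sum-indicator≡length-filter p []       = refl
  sum-indicator≡length-filter p (x ∷ xs) with p x
  ... | true  = cong suc (sum-indicator≡length-filter p xs)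
  ... | false = sum-indicator≡length-filter p xs

last-++-[] : ∀ {A : Set} (x : A) xs y → last x (xs ++ [ y ]) ≡ y
last-++-[] x []       y = refl
last-++-[] x (z ∷ xs) y = last-++-[] z xs y

∈⇒length>0 : ∀ {A : Set} {x : A} {xs} → x ∈ xs → 0 < length xs
∈⇒length>0 (here _)  = s≤s z≤n
∈⇒length>0 (there _) = s≤s z≤n

chord-length-+ : ∀ {A : Set} (xs : List A) y ys →
                 (3 + length xs) + (3 + length ys) ≡ (3 + length (xs ++ y ∷ ys)) + 2
chord-length-+ xs y ys rewrite length-++ xs {y ∷ ys} = lemma (length xs) (length ys)
  where
  lemma : ∀ a b → (3 + a) + (3 + b) ≡ (3 + (a + suc b)) + 2
  lemma = solve-∀

module _ {n : ℕ} (G : Graph n) where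

  adj-sym : ∀ {i j} → Adj G i j → Adj G j i
  adj-sym {i} {j} = trans (Graph.sym G j i)

  unique⇒length≤ : ∀ {xs : List (Fin n)} → Unique xs → length xs ≤ n
  unique⇒length≤ u = ≤-trans (unique-⊆⇒length≤ u (λ {j} _ → ∈-allFin j))
                             (≤-reflexive (length-tabulate (λ j → j)))

  chain-∷⁻ : ∀ {x} xs → Chain G (x ∷ xs) → Chain G xs
  chain-∷⁻ []      _       = tt
  chain-∷⁻ (_ ∷ _) (_ , c) = c

  chain-++⁻ˡ : ∀ xs {ys} → Chain G (xs ++ ys) → Chain G xs
  chain-++⁻ˡ []           _       = tt
  chain-++⁻ˡ (x ∷ [])     _       = tt
  chain-++⁻ˡ (x ∷ y ∷ xs) (a , c) = a , chain-++⁻ˡ (y ∷ xs) c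

  chain-++⁻ʳ : ∀ xs {ys} → Chain G (xs ++ ys) → Chain G ys
  chain-++⁻ʳ []       c = c
  chain-++⁻ʳ (x ∷ xs) c = chain-++⁻ʳ xs (chain-∷⁻ (xs ++ _) c)

  PathAvoiding : Fin n → List (Fin n) → Set
  PathAvoiding v xs = Unique (v ∷ xs) × Chain G xs

  avoiding-++⁻ˡ : ∀ {v} xs {ys} → PathAvoiding v (xs ++ ys) → PathAvoiding v xs
  avoiding-++⁻ˡ {v} xs (u , c) = unique-++⁻ˡ (v ∷ xs) u , chain-++⁻ˡ xs c

  avoiding-++⁻ʳ : ∀ {v} xs {ys} → PathAvoiding v (xs ++ ys) → PathAvoiding v ys
  avoiding-++⁻ʳ xs (v∉ ∷ u , c) = ++⁻ʳ xs v∉ ∷ unique-++⁻ʳ xs u , chain-++⁻ʳ xs c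

  chord-cycle : ∀ {v u w} mid {ys} → PathAvoiding v (u ∷ mid ++ w ∷ ys) →
                Adj G v u → Adj G v w → Σ (Cycle G) λ C → cycleLength C ≡ 3 + length mid
  chord-cycle {v} {u} {w} mid {ys} avoid vu vw =
    mkCycle v (u ∷ mid ++ [ w ]) length≥3 (proj₁ segment) (vu , proj₂ segment) closing , length≡
    where
    segment : PathAvoiding v (u ∷ mid ++ [ w ])
    segment = avoiding-++⁻ˡ (u ∷ mid ++ [ w ])
      (subst (PathAvoiding v) (cong (u ∷_) (sym (++-assoc mid [ w ] ys))) avoid)
    length≡ : 2 + length (mid ++ [ w ]) ≡ 3 + length mid
    length≡ = cong (2 +_) (trans (length-++ mid) (+-comm (length mid) 1))
    length≥3 : 3 ≤ 2 + length (mid ++ [ w ])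
    length≥3 = ≤-trans (s≤s (s≤s (s≤s z≤n))) (≤-reflexive (sym length≡))
    closing : Adj G (last v (u ∷ mid ++ [ w ])) v
    closing = subst (λ x → Adj G x v) (sym (last-++-[] u mid w)) (adj-sym vw)

  adjacent? : ∀ v → Decidable (Adj G v)
  adjacent? v j = adj G v j ≟ᵇ true

  neighboursIn : Fin n → List (Fin n) → List (Fin n)
  neighboursIn v = filter (adjacent? v)

  degree≡length-neighbours : ∀ v → degree G v ≡ length (neighboursIn v (allFin n))
  degree≡length-neighbours v = sum-indicator≡length-filter (adj G v) (allFin n)

  first-neighbour : ∀ {v k} xs → suc k ≤ length (neighboursIn v xs) →
    ∃[ before ] ∃[ u ] ∃[ after ]
      xs ≡ before ++ u ∷ after × Adj G v u × k ≤ length (neighboursIn v after)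
  first-neighbour {v} (x ∷ xs) k< with adj G v x in vx
  ... | true  = [] , x , xs , refl , vx , s≤s⁻¹ k<
  ... | false with before , u , after , refl , vu , k≤ ← first-neighbour xs k< =
    x ∷ before , u , after , refl , vu , k≤

  record MaximalPath : Set where
    field
      end         : Fin n
      next        : Fin n
      remaining   : List (Fin n)
      path-unique : Unique (end ∷ next ∷ remaining)
      path-chain  : Chain G (end ∷ next ∷ remaining)
      maximal     : ∀ {j} → Adj G end j → j ∈ next ∷ remaining

    avoiding : PathAvoiding end (next ∷ remaining)
    avoiding = path-unique , proj₂ path-chain

    degree>0 : 0 < degree G end
    degree>0 = subst (0 <_) (sym (degree≡length-neighbours end))
      (∈⇒length>0 (∈-filter⁺ (adjacent? end) (∈-allFin next) (proj₁ path-chain)))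

    degree≤neighbours-on-path : degree G end ≤ length (neighboursIn end (next ∷ remaining))
    degree≤neighbours-on-path = ≤-trans (≤-reflexive (degree≡length-neighbours end))
      (unique-⊆⇒length≤ (filter⁺ (adjacent? end) (allFin⁺ n)) neighbours⊆path)
      where
      neighbours⊆path : neighboursIn end (allFin n) ⊆ neighboursIn end (next ∷ remaining)
      neighbours⊆path j∈ with _ , ej ← ∈-filter⁻ (adjacent? end) {xs = allFin n} j∈ =
        ∈-filter⁺ (adjacent? end) (maximal ej) ej

  extend-to-maximal : ∀ fuel v u xs → Unique (v ∷ u ∷ xs) → Chain G (v ∷ u ∷ xs) →
                      n < fuel + length (v ∷ u ∷ xs) → MaximalPath
  extend-to-maximal zero v u xs distinct _ n< = contradiction (unique⇒length≤ distinct) (<⇒≱ n<)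
  extend-to-maximal (suc fuel) v u xs distinct linked n<
    with any? (λ j → adjacent? v j ×-dec ¬? (Any.any? (j ≟ᶠ_) (v ∷ u ∷ xs)))
  ... | yes (j , vj , j∉) =
    extend-to-maximal fuel j v (u ∷ xs) (¬Any⇒All¬ _ j∉ ∷ distinct) (adj-sym vj , linked)
      (subst (n <_) (sym (+-suc fuel _)) n<)
  ... | no no-extension = record
    { end = v ; next = u ; remaining = xs
    ; path-unique = distinct ; path-chain = linked ; maximal = maximal }
    where
    maximal : ∀ {j} → Adj G v j → j ∈ u ∷ xs
    maximal {j} vj = not-end (decidable-stable (Any.any? (j ≟ᶠ_) (v ∷ u ∷ xs))
                               λ j∉ → no-extension (j , vj , j∉))
      where
      not-end : j ∈ v ∷ u ∷ xs → j ∈ u ∷ xs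
      not-end (here j≡v) =
        contradiction (trans (sym (subst (Adj G v) j≡v vj)) (Graph.irrefl G v)) λ ()
      not-end (there j∈) = j∈

  cycle⇒maximal-path : Cycle G → MaximalPath
  cycle⇒maximal-path (mkCycle v (u ∷ xs) _ distinct linked _) =
    extend-to-maximal n v u xs distinct linked (m<m+n n (s≤s z≤n))
  cycle⇒maximal-path (mkCycle _ [] (s≤s ()) _ _ _)

  module _ (type01 : ∀ (C : Cycle G) → Type01 (cycleLength C)) where

    chord-type01 : ∀ {v u w} mid {ys} → PathAvoiding v (u ∷ mid ++ w ∷ ys) →
                   Adj G v u → Adj G v w → Type01 (3 + length mid)
    chord-type01 mid avoid vu vw with C , length≡ ← chord-cycle mid avoid vu vw =
      subst Type01 length≡ (type01 C)

    few-neighbours-on-path : ∀ {v} xs → PathAvoiding v xs → ¬ 4 ≤ length (neighboursIn v xs)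
    few-neighbours-on-path {v} xs avoid 4≤
      with P₀ , u₁ , T₁ , refl , a₁ , 3≤ ← first-neighbour xs 4≤
      with P₁ , u₂ , T₂ , refl , a₂ , 2≤ ← first-neighbour T₁ 3≤
      with P₂ , u₃ , T₃ , refl , a₃ , 1≤ ← first-neighbour T₂ 2≤
      with P₃ , u₄ , R  , refl , a₄ , _  ← first-neighbour T₃ 1≤ =
      contradiction (trans (sym ℓ₁₃≡0) ℓ₁₃≡1) λ ()
      where
      M₁₃ = P₁ ++ u₂ ∷ P₂
      M₁₄ = M₁₃ ++ u₃ ∷ P₃

      avoid₁ : PathAvoiding v (u₁ ∷ P₁ ++ u₂ ∷ P₂ ++ u₃ ∷ P₃ ++ u₄ ∷ R)
      avoid₁ = avoiding-++⁻ʳ P₀ avoid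
      avoid₂ = avoiding-++⁻ʳ (u₁ ∷ P₁) avoid₁
      avoid₃ = avoiding-++⁻ʳ (u₂ ∷ P₂) avoid₂

      avoid₁₃ : PathAvoiding v (u₁ ∷ M₁₃ ++ u₃ ∷ P₃ ++ u₄ ∷ R)
      avoid₁₃ = subst (PathAvoiding v) (cong (u₁ ∷_) (sym (++-assoc P₁ (u₂ ∷ P₂) _))) avoid₁

      avoid₁₄ : PathAvoiding v (u₁ ∷ M₁₄ ++ u₄ ∷ R)
      avoid₁₄ = subst (PathAvoiding v) (cong (u₁ ∷_) (sym (++-assoc M₁₃ (u₃ ∷ P₃) _))) avoid₁₃

      ℓ : List (Fin n) → ℕ
      ℓ mid = 3 + length mid

      ℓ₁₃≡0 : ℓ M₁₃ % 4 ≡ 0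
      ℓ₁₃≡0 = proj₂ (type01-shift (ℓ P₁) (ℓ P₂) (ℓ M₁₃)
        (chord-type01 P₁ avoid₁ a₁ a₂) (chord-type01 P₂ avoid₂ a₂ a₃)
        (chord-type01 M₁₃ avoid₁₃ a₁ a₃) (chord-length-+ P₁ u₂ P₂))

      ℓ₁₃≡1 : ℓ M₁₃ % 4 ≡ 1
      ℓ₁₃≡1 = proj₁ (type01-shift (ℓ M₁₃) (ℓ P₃) (ℓ M₁₄)
        (chord-type01 M₁₃ avoid₁₃ a₁ a₃) (chord-type01 P₃ avoid₃ a₃ a₄)
        (chord-type01 M₁₄ avoid₁₄ a₁ a₄) (chord-length-+ M₁₃ u₃ P₃))

theorem4 : ∀ (n : ℕ) (G : Graph n) → Eps01 G → ∃[ v ] (degree G v ≡ 2)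
theorem4 n G ((_ , even) , type01 , (C , _) , _) with any? (λ v → degree G v ≟ 2)
... | yes deg2 = deg2
... | no ¬deg2 = contradiction (≤-trans degree≥4 degree≤neighbours-on-path)
                   (few-neighbours-on-path G type01 (next ∷ remaining) avoiding)
  where
  open MaximalPath (cycle⇒maximal-path G C)
  degree≥4 : 4 ≤ degree G end
  degree≥4 = even-≢2⇒≥4 (even end) degree>0 λ deg2 → ¬deg2 (end , deg2)
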